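{- Let $T=(\mathbf{P},A,\to)$ be an LTS with signature $\{A^r,A^l,A^{bi}\}$, and let $\mathcal{T}(T)$ be as in the context. Then for all states $p,q\in\mathbf{P}$: $p\lesssim_{cc}q$ in $T$ if and only if $p\lesssim_{cc}q$ in $\mathcal{T}(T)$.
   Context: A signature $\{A^r,A^l,A^{bi}\}$ is a partition of the action set $A$ into covariant ($A^r$), contravariant ($A^l$) and bivariant ($A^{bi}$) actions. For an LTS with such a signature, a covariant-contravariant simulation is a relation $R$ on states such that whenever $p\,R\,q$: for all $a\in A^r\cup A^{bi}$ and all $p\xrightarrow{a}p'$ there is $q\xrightarrow{a}q'$ with $p'\,R\,q'$; and for all $a\in A^l\cup A^{bi}$ and all $q\xrightarrow{a}q'$ there is $p\xrightarrow{a}p'$ with $p'\,R\,q'$; $p\lesssim_{cc}q$ iff some such $R$ contains $(p,q)$. The LTS $\mathcal{T}(T)$ has signature $\{\bar A^r,\bar A^l,\emptyset\}$ with $\bar A^r=A^r\cup\{c^r\mid c\in A^{bi}\}$ and $\bar A^l=A^l\cup\{c^l\mid c\in A^{bi}\}$ (fresh actions $c^r,c^l$); its states are those of $T$; it contains all transitions of $T$ labelled in $A^r\cup A^l$, and for each transition $p\xrightarrow{c}p'$ of $T$ with $c\in A^{bi}$ it contains $p\xrightarrow{c^r}p'$ and $p\xrightarrow{c^l}p'$ (and nothing else). -}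

module Defs where

open import Level using (Level; _⊔_; suc)
open import Data.Bool using (Bool; true; false; not; T)
open import Data.Product using (Σ; _×_; _,_; ∃)
open import Data.Sum using (_⊎_)
open import Relation.Binary.PropositionalEquality using (_≡_)

-- Kinds of actions: covariant (r), contravariant (l), bivariant (bi).
data Kind : Set where
  r l bi : Kind

isBi : Kind → Bool
isBi bi = true
isBi _  = false

record LTS (ℓ : Level) : Set (suc ℓ) where
  field
    P    : Set ℓ
    A    : Set ℓ
    sig  : A → Kind
    _⟶⟨_⟩_ : P → A → P → Set ℓ

module _ {ℓ : Level} (S : LTS ℓ) where
  open LTS S

  IsCCSim : (P → P → Set ℓ) → Set ℓ
  IsCCSim R = ∀ {p q} → R p q →
      (∀ (a : A) → (sig a ≡ r ⊎ sig a ≡ bi) → ∀ {p'} → p ⟶⟨ a ⟩ p' →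
          Σ P λ q' → (q ⟶⟨ a ⟩ q') × R p' q')
    × (∀ (a : A) → (sig a ≡ l ⊎ sig a ≡ bi) → ∀ {q'} → q ⟶⟨ a ⟩ q' →
          Σ P λ p' → (p ⟶⟨ a ⟩ p') × R p' q')

  _≲cc_ : P → P → Set (suc ℓ)
  p ≲cc q = Σ (P → P → Set ℓ) λ R → IsCCSim R × R p q

data TAct {ℓ : Level} (A : Set ℓ) (sig : A → Kind) : Set ℓ where
  orig : (a : A) → T (not (isBi (sig a))) → TAct A sig
  _ʳ   : (c : A) → T (isBi (sig c)) → TAct A sig
  _ˡ   : (c : A) → T (isBi (sig c)) → TAct A sig

module _ {ℓ : Level} (S : LTS ℓ) where
  open LTS S

  Tsig : TAct A sig → Kind
  Tsig (orig a _) = sig a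
  Tsig ((c ʳ) _)  = r
  Tsig ((c ˡ) _)  = l

  data Ttrans : P → TAct A sig → P → Set ℓ where
    t-orig : ∀ {p p' a} (h : T (not (isBi (sig a)))) → p ⟶⟨ a ⟩ p' → Ttrans p (orig a h) p'
    t-r    : ∀ {p p' c} (h : T (isBi (sig c))) → p ⟶⟨ c ⟩ p' → Ttrans p ((c ʳ) h) p'
    t-l    : ∀ {p p' c} (h : T (isBi (sig c))) → p ⟶⟨ c ⟩ p' → Ttrans p ((c ˡ) h) p'

  𝒯 : LTS ℓ
  𝒯 = record { P = P ; A = TAct A sig ; sig = Tsig ; _⟶⟨_⟩_ = Ttrans }

module Submission where

-- A relation R on the states of T is a covariant-contravariant simulation
-- of T exactly when it is one of 𝒯(T); since both LTSs have the same states,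
-- the two preorders ≲cc then coincide, witnessed by the very same relation.
--
-- The simulation condition splits into a "forth" clause (covariant and
-- bivariant steps of the left state are matched on the right) and a "back"
-- clause (contravariant and bivariant steps of the right state are matched
-- on the left).  Each clause is transferred between T and 𝒯(T) separately:
--   * an action of 𝒯(T) is either an original non-bivariant action, handled
--     verbatim, or a copy cʳ / cˡ of a bivariant c, where cʳ only takes part
--     in the forth clause and cˡ only in the back clause;
--   * conversely a covariant (resp. contravariant) action of T is an original
--     action of 𝒯(T), and a bivariant c is simulated through cʳ in the forth
--     clause and through cˡ in the back clause.

open import Defs
open import Level using (Level)
open import Function.Bundles using (_⇔_; mk⇔)
open import Data.Bool using (not; T)
open import Data.Unit using (tt)
open import Data.Product using (Σ; _×_; _,_; proj₁; proj₂)
open import Data.Sum using (_⊎_; inj₁; inj₂)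
open import Relation.Binary.PropositionalEquality using (_≡_; refl)

isBi⇒≡bi : ∀ {k} → T (isBi k) → k ≡ bi
isBi⇒≡bi {bi} _ = refl

≡bi⇒isBi : ∀ {k} → k ≡ bi → T (isBi k)
≡bi⇒isBi refl = tt

r⊎l⇒notBi : ∀ {k} → k ≡ r ⊎ k ≡ l → T (not (isBi k))
r⊎l⇒notBi (inj₁ refl) = tt
r⊎l⇒notBi (inj₂ refl) = tt

-- The two clauses of the cc-simulation condition for a pair (p , q);
-- IsCCSim S R unfolds to  ∀ {p q} → R p q → Forth S R p q × Back S R p q.
module _ {ℓ : Level} (S : LTS ℓ) where
  open LTS S

  Forth : (P → P → Set ℓ) → P → P → Set ℓ
  Forth R p q = ∀ (a : A) → (sig a ≡ r ⊎ sig a ≡ bi) → ∀ {p'} → p ⟶⟨ a ⟩ p' →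
    Σ P λ q' → (q ⟶⟨ a ⟩ q') × R p' q'

  Back : (P → P → Set ℓ) → P → P → Set ℓ
  Back R p q = ∀ (a : A) → (sig a ≡ l ⊎ sig a ≡ bi) → ∀ {q'} → q ⟶⟨ a ⟩ q' →
    Σ P λ p' → (p ⟶⟨ a ⟩ p') × R p' q'

module _ {ℓ : Level} (S : LTS ℓ) {R : LTS.P S → LTS.P S → Set ℓ}
         {p q : LTS.P S} where

  -- The forth clause in T yields the forth clause in 𝒯(T): original actions
  -- are matched verbatim, cʳ through c, and cˡ is never covariant.
  forth-to-𝒯 : Forth S R p q → Forth (𝒯 S) R p q
  forth-to-𝒯 forth (orig a h) cov (t-orig _ p⟶p') with forth a cov p⟶p'
  ... | q' , q⟶q' , R' = q' , t-orig h q⟶q' , R'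
  forth-to-𝒯 forth ((c ʳ) h) _ (t-r _ p⟶p') with forth c (inj₂ (isBi⇒≡bi h)) p⟶p'
  ... | q' , q⟶q' , R' = q' , t-r h q⟶q' , R'
  forth-to-𝒯 forth ((c ˡ) h) (inj₁ ()) _
  forth-to-𝒯 forth ((c ˡ) h) (inj₂ ()) _

  back-to-𝒯 : Back S R p q → Back (𝒯 S) R p q
  back-to-𝒯 back (orig a h) contra (t-orig _ q⟶q') with back a contra q⟶q'
  ... | p' , p⟶p' , R' = p' , t-orig h p⟶p' , R'
  back-to-𝒯 back ((c ˡ) h) _ (t-l _ q⟶q') with back c (inj₂ (isBi⇒≡bi h)) q⟶q'
  ... | p' , p⟶p' , R' = p' , t-l h p⟶p' , R'
  back-to-𝒯 back ((c ʳ) h) (inj₁ ()) _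
  back-to-𝒯 back ((c ʳ) h) (inj₂ ()) _

  -- The forth clause in 𝒯(T) yields it in T: a covariant a is an original
  -- action of 𝒯(T), a bivariant c is simulated via cʳ.  The matching step of
  -- 𝒯(T) necessarily comes from a step of T with the same label.
  forth-from-𝒯 : Forth (𝒯 S) R p q → Forth S R p q
  forth-from-𝒯 forth a (inj₁ sa≡r) p⟶p'
    with forth (orig a (r⊎l⇒notBi (inj₁ sa≡r))) (inj₁ sa≡r) (t-orig _ p⟶p')
  ... | q' , t-orig _ q⟶q' , R' = q' , q⟶q' , R'
  forth-from-𝒯 forth c (inj₂ sc≡bi) p⟶p'
    with forth ((c ʳ) (≡bi⇒isBi sc≡bi)) (inj₁ refl) (t-r _ p⟶p')
  ... | q' , t-r _ q⟶q' , R' = q' , q⟶q' , R'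

  back-from-𝒯 : Back (𝒯 S) R p q → Back S R p q
  back-from-𝒯 back a (inj₁ sa≡l) q⟶q'
    with back (orig a (r⊎l⇒notBi (inj₂ sa≡l))) (inj₁ sa≡l) (t-orig _ q⟶q')
  ... | p' , t-orig _ p⟶p' , R' = p' , p⟶p' , R'
  back-from-𝒯 back c (inj₂ sc≡bi) q⟶q'
    with back ((c ˡ) (≡bi⇒isBi sc≡bi)) (inj₁ refl) (t-l _ q⟶q')
  ... | p' , t-l _ p⟶p' , R' = p' , p⟶p' , R'

module _ {ℓ : Level} (S : LTS ℓ) {R : LTS.P S → LTS.P S → Set ℓ} where

  ccSim-to-𝒯 : IsCCSim S R → IsCCSim (𝒯 S) R
  ccSim-to-𝒯 sim Rpq = forth-to-𝒯 S (proj₁ (sim Rpq)) , back-to-𝒯 S (proj₂ (sim Rpq))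

  ccSim-from-𝒯 : IsCCSim (𝒯 S) R → IsCCSim S R
  ccSim-from-𝒯 sim Rpq = forth-from-𝒯 S (proj₁ (sim Rpq)) , back-from-𝒯 S (proj₂ (sim Rpq))

corollary23 : {ℓ : Level} (S : LTS ℓ) (p q : LTS.P S) →
    _≲cc_ S p q ⇔ _≲cc_ (𝒯 S) p q
corollary23 S p q = mk⇔
  (λ { (R , sim , Rpq) → R , ccSim-to-𝒯 S sim , Rpq })
  (λ { (R , sim , Rpq) → R , ccSim-from-𝒯 S sim , Rpq })
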